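{- Let $\mathcal{S}=(\overline{x},\overline{i},\overline{c},I,T)$ be a controllable finite-state transition system with complete and deterministic transition relation $T$, and let $P(\overline{x})$ be a formula of safe states such that the specification $(\mathcal{S},P)$ is realizable. Let $G(\overline{x})$ be a propositional formula over the state variables and let $\mathbf{x}_g$ be a cube over $\overline{x}$. Suppose the quantified Boolean formula \[ \exists \overline{x}^*, \overline{i}^*, \overline{c}^*\,.\, \exists \overline{x}\,.\,\forall \overline{i}\,.\,\exists \overline{c},\overline{x}'\,.\, \Big(I(\overline{x}) \vee \big(G(\overline{x}^*) \wedge \neg \mathbf{x}_g(\overline{x}^*) \wedge T(\overline{x}^*, \overline{i}^*, \overline{c}^*, \overline{x})\big)\Big) \wedge \mathbf{x}_g(\overline{x}) \wedge G(\overline{x}) \wedge T(\overline{x},\overline{i},\overline{c},\overline{x}') \wedge G(\overline{x}') \] is unsatisfiable (false), where $\overline{x}^*,\overline{i}^*,\overline{c}^*$ are fresh copies of $\overline{x},\overline{i},\overline{c}$. Then for every winning region $W(\overline{x})$ with $W\Rightarrow G$ and $W \Rightarrow \mathrm{F}^1_{\mathcal{S}}(W)$, and every implementation $\mathcal{I}$ derived from $W$, there is no state $\mathbf{x}_a$ with $\mathbf{x}_a\models G\wedge \mathbf{x}_g$ such that both (a) the protagonist can enforce to visit $G$ in one step from $\mathbf{x}_a$, i.e. $\mathbf{x}_a \models \mathrm{F}^1_{\mathcal{S}}(G)$, and (b) $\mathbf{x}_a$ is reachable in $\mathcal{I}$.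
   Context: A controllable finite-state transition system is a tuple $\mathcal{S}=(\overline{x},\overline{i},\overline{c},I,T)$ where $\overline{x}$ are Boolean state variables, $\overline{i}$ uncontrollable input variables, $\overline{c}$ controllable input variables, $I(\overline{x})$ the initial condition, and $T(\overline{x},\overline{i},\overline{c},\overline{x}')$ the transition relation ($\overline{x}'$ the next-state copy of $\overline{x}$). $T$ is assumed complete and deterministic: for every state and input assignment there is exactly one successor. A state is an $\overline{x}$-minterm (full assignment); a formula over $\overline{x}$ denotes the set of states satisfying it; $F'$ denotes $F$ with all variables replaced by next-state copies. A cube is a conjunction of literals; for a cube $\mathbf{x}_g$ over $\overline{x}$, $\mathbf{x}_g(\overline{x}^*)$ means the same cube over the copy $\overline{x}^*$. An execution is a sequence of states $\mathbf{x}_0,\mathbf{x}_1,\dots$ with $\mathbf{x}_0\models I$ and for each $j$ some inputs $\mathbf{i}_j,\mathbf{c}_j$ with $\mathbf{x}_j\wedge\mathbf{i}_j\wedge\mathbf{c}_j\wedge\mathbf{x}_{j+1}'\models T$; a state is reachable if it occurs in some execution. In each step the antagonist picks $\overline{i}$, then the protagonist picks $\overline{c}$. $\mathrm{F}^1_{\mathcal{S}}(F) := \forall\overline{i}\,.\,\exists\overline{c},\overline{x}'\,.\,T\wedge F'$ (states from which the protagonist can enforce reaching $F$ in one step). A controller is a function $f$ from assignments of $(\overline{x},\overline{i})$ to assignments of $\overline{c}$. Given a safe-state formula $P(\overline{x})$, the specification $(\mathcal{S},P)$ is realizable if there exists a controller $f$ such that every execution of $\mathcal{S}$ in which the controllable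 inputs are chosen as $\mathbf{c}_j=f(\mathbf{x}_j,\mathbf{i}_j)$ visits only states satisfying $P$. A winning region is a formula $W(\overline{x})$ with $I\Rightarrow W$, $W\Rightarrow P$, and $W\Rightarrow \mathrm{F}^1_{\mathcal{S}}(W)$. An implementation derived from $W$ is the transition system $\mathcal{I}=(\overline{x},\overline{i},\emptyset,I,T(\overline{x},\overline{i},f(\overline{x},\overline{i}),\overline{x}'))$ for a controller $f$ that, from every state in $W$ and for every input $\overline{i}$, chooses $\overline{c}$ so that the successor state again satisfies $W$; reachability in $\mathcal{I}$ is defined as for $\mathcal{S}$. -}

module Defs where

open import Data.Nat using (ℕ)
open import Data.Bool using (Bool; true; false)
open import Data.Fin using (Fin)
open import Data.Vec using (Vec; lookup)
open import Data.List using (List)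
open import Data.List.Relation.Unary.All using (All)
open import Data.Product using (Σ; ∃; ∃-syntax; _×_; _,_)
open import Data.Sum using (_⊎_)
open import Relation.Binary.PropositionalEquality using (_≡_)
open import Relation.Nullary using (¬_)

Assignment : ℕ → Set
Assignment n = Vec Bool n

-- A propositional formula over n variables, identified with the Boolean
-- function it denotes (its truth table).
Formula : ℕ → Set
Formula n = Assignment n → Bool

-- A controllable finite-state transition system (x̄, ī, c̄, I, T) with
-- nx state variables, ni uncontrollable and nc controllable inputs.
record System (nx ni nc : ℕ) : Set where
  field
    I : Formula nx
    T : Assignment nx → Assignment ni → Assignment nc → Assignment nx → Bool

module _ {nx ni nc : ℕ} (S : System nx ni nc) where
  open System S

  CompleteDeterministic : Set
  CompleteDeterministic =
    ∀ x i c → Σ (Assignment nx) λ x' →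
      (T x i c x' ≡ true) × (∀ y → T x i c y ≡ true → y ≡ x')

  F1 : (Assignment nx → Set) → Assignment nx → Set
  F1 F x = ∀ i → ∃[ c ] ∃[ x' ] (T x i c x' ≡ true × F x')

  Controller : Set
  Controller = Assignment nx → Assignment ni → Assignment nc

  data ReachableUnder (f : Controller) : Assignment nx → Set where
    init : ∀ {x} → I x ≡ true → ReachableUnder f x
    step : ∀ {x} i {x'} → ReachableUnder f x →
           T x i (f x i) x' ≡ true → ReachableUnder f x'

  Realizable : Formula nx → Set
  Realizable P = Σ Controller λ f → ∀ x → ReachableUnder f x → P x ≡ true

  WinningRegion : Formula nx → Formula nx → Set
  WinningRegion P W =
    (∀ x → I x ≡ true → W x ≡ true) ×
    (∀ x → W x ≡ true → P x ≡ true) ×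
    (∀ x → W x ≡ true → F1 (λ y → W y ≡ true) x)

  -- f is a controller of an implementation derived from W:
  -- from every W-state and every input it keeps the successor in W.
  DerivedFrom : Formula nx → Controller → Set
  DerivedFrom W f =
    ∀ x i x' → W x ≡ true → T x i (f x i) x' ≡ true → W x' ≡ true

-- A cube: conjunction of literals (variable index, polarity).
Cube : ℕ → Set
Cube n = List (Fin n × Bool)

_⊨cube_ : ∀ {n} → Assignment n → Cube n → Set
x ⊨cube g = All (λ { (v , b) → lookup x v ≡ b }) g

QBF : ∀ {nx ni nc} → System nx ni nc → Formula nx → Cube nx → Set
QBF {nx} {ni} {nc} S G g =
  Σ (Assignment nx) λ xs → Σ (Assignment ni) λ is → Σ (Assignment nc) λ cs →
  Σ (Assignment nx) λ x → ∀ (i : Assignment ni) →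
  Σ (Assignment nc) λ c → Σ (Assignment nx) λ x' →
    ((System.I S x ≡ true) ⊎
      ((G xs ≡ true) × (¬ (xs ⊨cube g)) × (System.T S xs is cs x ≡ true)))
    × (x ⊨cube g) × (G x ≡ true)
    × (System.T S x i c x' ≡ true) × (G x' ≡ true)

-- Every state reachable in the implementation lies in W, hence in G.  Follow
-- the execution reaching a G ∧ x_g state x_a backwards: as long as the
-- predecessor still satisfies the cube, it is itself a reachable G ∧ x_g
-- state from which G can be enforced (W ⊆ F¹(W) ⊆ F¹(G)), so we may move to
-- it.  Eventually we reach either an initial state or a state whose
-- predecessor lies in G ∖ x_g; either case is a model of the QBF.
module Submission where

open import Defs
open import Data.Nat using (ℕ)
open import Data.Bool using (true)
open import Data.Bool.Properties using () renaming (_≟_ to _≟ᵇ_)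
open import Data.Product using (Σ; _×_; _,_)
open import Data.Sum using (_⊎_; inj₁; inj₂)
open import Data.Vec using (replicate; lookup)
open import Data.List.Relation.Unary.All using (all?)
open import Relation.Binary.PropositionalEquality using (_≡_)
open import Relation.Nullary using (¬_; yes; no; Dec)

_⊨cube?_ : ∀ {n} (x : Assignment n) (g : Cube n) → Dec (x ⊨cube g)
x ⊨cube? g = all? (λ { (v , b) → lookup x v ≟ᵇ b }) g

module _ {nx ni nc : ℕ} (S : System nx ni nc) where
  open System S

  F1-mono : {A B : Assignment nx → Set} → (∀ {x} → A x → B x) →
            ∀ {x} → F1 S A x → F1 S B x
  F1-mono A⇒B F i with F i
  ... | c , x' , t , a = c , x' , t , A⇒B a

  reachable⇒inv : (W : Formula nx) (f : Controller S) →
    (∀ x → I x ≡ true → W x ≡ true) → DerivedFrom S W f →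
    ∀ {x} → ReachableUnder S f x → W x ≡ true
  reachable⇒inv W f I⇒W inv (ReachableUnder.init i) = I⇒W _ i
  reachable⇒inv W f I⇒W inv (ReachableUnder.step i r t) =
    inv _ i _ (reachable⇒inv W f I⇒W inv r) t

  module _ (G : Formula nx) (g : Cube nx) where

    QBF-intro : ∀ xs is cs x →
      (I x ≡ true ⊎ (G xs ≡ true × ¬ (xs ⊨cube g) × T xs is cs x ≡ true)) →
      x ⊨cube g → G x ≡ true → F1 S (λ y → G y ≡ true) x → QBF S G g
    QBF-intro xs is cs x pre gx Gx F = xs , is , cs , x , λ i →
      let (c , x' , t , Gx') = F i in c , x' , pre , gx , Gx , t , Gx'

    no-reachable-cube-state : ¬ QBF S G g →
      (W : Formula nx) (f : Controller S) →
      (∀ x → I x ≡ true → W x ≡ true) →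
      (∀ x → W x ≡ true → F1 S (λ y → W y ≡ true) x) →
      (∀ x → W x ≡ true → G x ≡ true) → DerivedFrom S W f →
      ∀ {x} → G x ≡ true → x ⊨cube g →
      F1 S (λ y → G y ≡ true) x → ¬ ReachableUnder S f x
    no-reachable-cube-state ¬qbf W f I⇒W W⇒F1W W⇒G inv = go
      where
      inW : ∀ {x} → ReachableUnder S f x → W x ≡ true
      inW = reachable⇒inv W f I⇒W inv

      go : ∀ {x} → G x ≡ true → x ⊨cube g →
           F1 S (λ y → G y ≡ true) x → ¬ ReachableUnder S f x
      -- The x* copies are irrelevant in the I(x) branch of the QBF.
      go {x} Gx gx F (ReachableUnder.init Ix) =
        ¬qbf (QBF-intro (replicate _ true) (replicate _ true)
                        (replicate _ true) x (inj₁ Ix) gx Gx F)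
      go {x} Gx gx F (ReachableUnder.step {y} i r t) with y ⊨cube? g
      ... | yes gy =
        go (W⇒G y (inW r)) gy
           (F1-mono (λ {z} → W⇒G z) (W⇒F1W y (inW r))) r
      ... | no ¬gy =
        ¬qbf (QBF-intro y i _ x (inj₂ (W⇒G y (inW r) , ¬gy , t)) gx Gx F)

theorem1 : {nx ni nc : ℕ} (S : System nx ni nc) (P : Formula nx) →
    CompleteDeterministic S → Realizable S P →
    (G : Formula nx) (g : Cube nx) → ¬ QBF S G g →
    (W : Formula nx) → WinningRegion S P W →
    (∀ x → W x ≡ true → G x ≡ true) →
    (f : Controller S) → DerivedFrom S W f →
    ¬ (Σ (Assignment nx) λ xa →
        (G xa ≡ true) × (xa ⊨cube g) ×
        F1 S (λ y → G y ≡ true) xa × ReachableUnder S f xa)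
theorem1 S P _ _ G g ¬qbf W (I⇒W , _ , W⇒F1W) W⇒G f inv (xa , Gxa , gxa , F , r) =
  no-reachable-cube-state S G g ¬qbf W f I⇒W W⇒F1W W⇒G inv Gxa gxa F r
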